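{- Consider an $N\times M$ matrix and a set $\mathcal{N}$ of nodes over it such that no two nodes cover exactly the same set of positions and every single position $\{(x,y)\}$ is a node. Let $\bigtriangledown$ be a binary operator and let $S_U$ be a function assigning to each submatrix $B$ a set $S_U(B)\subseteq\mathcal{N}$ with $\bigcup_{n\in S_U(B)}n=B$, whose nodes are pairwise disjoint if $\bigtriangledown$ is not idempotent. Define the update $U(B,v)$ to visit every node of $S_U(B)$ and every node $m\in\mathcal{N}$ such that $m\cap n\neq\emptyset$ for some $n\in S_U(B)$ but $m\not\subseteq n$ for every $n\in S_U(B)$. Then there exists a submatrix $B$ for which $U(B,v)$ visits at least $\frac{NM}{N+M}$ nodes.
   Context: A submatrix $[x_0,x_1][y_0,y_1]$ is the set of positions $(x,y)$ with $x_0\le x\le x_1$, $y_0\le y\le y_1$, where $0\le x<N$, $0\le y<M$. A node is an arbitrary nonempty set of positions of the matrix (not necessarily a submatrix). This models a data structure storing for each node a value and a lazy value, in which an update applies its lazy change to the nodes of $S_U(B)$ and recomputes the values of the other nodes it visits. -}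

module Defs where

open import Data.Nat using (ℕ; _*_; _+_; _≤_)
open import Data.Fin using (Fin) renaming (_≤_ to _≤ᶠ_)
open import Data.Bool using (Bool; true)
open import Data.Product using (Σ; ∃; ∃-syntax; _×_)
open import Data.Sum using (_⊎_)
open import Relation.Binary.PropositionalEquality using (_≡_; _≢_)
open import Relation.Nullary using (¬_)
open import Function.Bundles using (_⇔_)
open import Function.Definitions using (Injective)
open import Algebra.Definitions using (Idempotent)

PosSet : ℕ → ℕ → Set
PosSet N M = Fin N → Fin M → Bool

_∈ₚ_ : ∀ {N M} → Fin N × Fin M → PosSet N M → Set
_∈ₚ_ (x Data.Product., y) S = S x y ≡ true

record Submatrix (N M : ℕ) : Set where
  constructor sub
  field
    x₀ x₁ : Fin N
    y₀ y₁ : Fin M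
    x₀≤x₁ : x₀ ≤ᶠ x₁
    y₀≤y₁ : y₀ ≤ᶠ y₁

InSub : ∀ {N M} → Submatrix N M → Fin N → Fin M → Set
InSub B x y = (Submatrix.x₀ B ≤ᶠ x × x ≤ᶠ Submatrix.x₁ B)
            × (Submatrix.y₀ B ≤ᶠ y × y ≤ᶠ Submatrix.y₁ B)

record NodeSystem (N M K : ℕ) (node : Fin K → PosSet N M) : Set where
  field
    nonempty : ∀ i → ∃[ x ] ∃[ y ] node i x y ≡ true
    distinct : ∀ i j → (∀ x y → node i x y ≡ node j x y) → i ≡ j
    singletons : ∀ x y → ∃[ i ] (∀ x' y' → (node i x' y' ≡ true) ⇔ (x' ≡ x × y' ≡ y))

Intersects : ∀ {N M} → PosSet N M → PosSet N M → Set
Intersects S T = ∃[ x ] ∃[ y ] (S x y ≡ true × T x y ≡ true)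

Subset : ∀ {N M} → PosSet N M → PosSet N M → Set
Subset S T = ∀ x y → S x y ≡ true → T x y ≡ true

record ValidSU {A : Set} (_▽_ : A → A → A) {N M K : ℕ}
               (node : Fin K → PosSet N M)
               (SU : Submatrix N M → Fin K → Bool) : Set where
  field
    cover : ∀ B x y → InSub B x y ⇔ (∃[ i ] (SU B i ≡ true × node i x y ≡ true))
    disjoint : ¬ Idempotent _≡_ _▽_ →
               ∀ B i j → SU B i ≡ true → SU B j ≡ true → i ≢ j →
               ¬ Intersects (node i) (node j)

Visited : ∀ {N M K} (node : Fin K → PosSet N M)
          (SU : Submatrix N M → Fin K → Bool) → Submatrix N M → Fin K → Set
Visited node SU B m =
  SU B m ≡ true ⊎
  ((∃[ n ] (SU B n ≡ true × Intersects (node m) (node n)))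
   × (∀ n → SU B n ≡ true → ¬ Subset (node m) (node n)))

VisitsAtLeast : ∀ {N M K} (node : Fin K → PosSet N M)
                (SU : Submatrix N M → Fin K → Bool) → Submatrix N M → ℕ → Set
VisitsAtLeast {K = K} node SU B c =
  Σ (Fin c → Fin K) λ f → Injective _≡_ _≡_ f × (∀ k → Visited node SU B (f k))

-- Put the rows and the columns of the matrix, N + M submatrices in all, in charge of the
-- N M positions.  For a position p = (r, c) let ρ be the node of S_U(row r) and κ the node
-- of S_U(column c) that contain p.  If ρ is not the singleton {p}, it meets κ ∈ S_U(column c)
-- but sticks out of column c, so U(column c) visits ρ; charge p to column c.  Otherwise charge
-- p to row r: U(row r) visits κ, either because κ sticks out of row r in the same way, or
-- because κ = {p} = ρ lies in S_U(row r).  Distinct positions of one row (column) yield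
-- distinct visited nodes, since the node charged for (r, c) is contained in column c (row r).
-- Some of the N + M submatrices is charged at least N M / (N + M) times.
module Submission where

open import Defs
open import Data.Nat using (ℕ; _*_; _+_; _≤_; NonZero; zero; suc; _<_; _≤?_; z≤n; s≤s)
open import Data.Fin using (Fin; zero; suc; fromℕ)
open import Data.Bool using (Bool; true; false; not) renaming (_≟_ to _≟ᵇ_)
open import Data.Product using (∃; ∃-syntax; _×_; _,_; proj₁; proj₂)

open import Data.Bool.Properties using (⇔→≡; T-≡)
open import Data.Empty using (⊥-elim)
open import Data.Fin.Properties using (any?; ≤-antisym; ≤-refl; ≤fromℕ; suc-injective; _≟_)
open import Data.Nat.Properties
  using ( +-0-commutativeMonoid; +-commutativeSemigroup; +-comm; *-identityʳ; *-comm; *-distribʳ-+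
        ; +-mono-≤; +-monoʳ-≤; ≤-trans; ≰⇒>; m+1+n≰m; module ≤-Reasoning)
open import Algebra.Properties.CommutativeMonoid.Sum +-0-commutativeMonoid
  using (sum; ∑-comm; ∑-distrib-+; sum-cong-≗)
open import Algebra.Properties.CommutativeSemigroup +-commutativeSemigroup using (interchange; x∙yz≈y∙xz)
open import Data.Sum using (_⊎_; inj₁; inj₂; [_,_]′)
open import Function using (_∘_; mk⇔)
open import Function.Bundles using (Equivalence)
open import Function.Definitions using (Injective)
open import Relation.Binary.PropositionalEquality
  using (_≡_; refl; sym; trans; cong; cong₂; subst; module ≡-Reasoning)
open import Relation.Nullary using (¬_; Dec; yes; no)
open import Relation.Nullary.Decidable using (_×-dec_; ¬?; isYes; toWitness; toWitnessFalse)

open Equivalence using (to; from)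

indicator : Bool → ℕ
indicator true = 1
indicator false = 0

count : ∀ {k} → (Fin k → Bool) → ℕ
count p = sum (indicator ∘ p)

sum-const : ∀ k c → sum {k} (λ _ → c) ≡ k * c
sum-const zero c = refl
sum-const (suc k) c = cong (c +_) (sum-const k c)

indicator-complement : ∀ b → indicator (not b) + indicator b ≡ 1
indicator-complement true = refl
indicator-complement false = refl

count-complement : ∀ {k} (p : Fin k → Bool) → count (not ∘ p) + count p ≡ k
count-complement {k} p = begin
  count (not ∘ p) + count p
    ≡⟨ sym (∑-distrib-+ (indicator ∘ not ∘ p) (indicator ∘ p)) ⟩
  sum (λ i → indicator (not (p i)) + indicator (p i))
    ≡⟨ sum-cong-≗ (indicator-complement ∘ p) ⟩
  sum {k} (λ _ → 1)
    ≡⟨ trans (sum-const k 1) (*-identityʳ k) ⟩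
  k
    ∎
  where open ≡-Reasoning

count-rows+count-columns : ∀ {n m} (g : Fin n → Fin m → Bool) →
  sum (λ r → count (not ∘ g r)) + sum (λ c → count (λ r → g r c)) ≡ n * m
count-rows+count-columns {n} {m} g = begin
  sum (λ r → count (not ∘ g r)) + sum (λ c → count (λ r → g r c))
    ≡⟨ cong (sum (λ r → count (not ∘ g r)) +_) (sym (∑-comm (λ r c → indicator (g r c)))) ⟩
  sum (λ r → count (not ∘ g r)) + sum (λ r → count (g r))
    ≡⟨ sym (∑-distrib-+ (λ r → count (not ∘ g r)) (λ r → count (g r))) ⟩
  sum (λ r → count (not ∘ g r) + count (g r))
    ≡⟨ sum-cong-≗ (count-complement ∘ g) ⟩
  sum {n} (λ _ → m)
    ≡⟨ sum-const n m ⟩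
  n * m
    ∎
  where open ≡-Reasoning

enumerate : ∀ {k} (p : Fin k → Bool) → Fin (count p) → Fin k
enumerate {suc k} p j with p zero
enumerate {suc k} p zero    | true  = zero
enumerate {suc k} p (suc j) | true  = suc (enumerate (p ∘ suc) j)
enumerate {suc k} p j       | false = suc (enumerate (p ∘ suc) j)

enumerate-sound : ∀ {k} (p : Fin k → Bool) j → p (enumerate p j) ≡ true
enumerate-sound {suc k} p j with p zero in eq
enumerate-sound {suc k} p zero    | true  = eq
enumerate-sound {suc k} p (suc j) | true  = enumerate-sound (p ∘ suc) j
enumerate-sound {suc k} p j       | false = enumerate-sound (p ∘ suc) j

enumerate-injective : ∀ {k} (p : Fin k → Bool) → Injective _≡_ _≡_ (enumerate p)
enumerate-injective {suc k} p {i} {j} eq with p zero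
enumerate-injective {suc k} p {zero}  {zero}  eq | true = refl
enumerate-injective {suc k} p {suc i} {suc j} eq | true =
  cong suc (enumerate-injective (p ∘ suc) (suc-injective eq))
enumerate-injective {suc k} p {i} {j} eq | false = enumerate-injective (p ∘ suc) (suc-injective eq)

sum-scaled-bound : ∀ {k} (f : Fin k → ℕ) d s → (∀ i → f i * d < s) → k + sum f * d ≤ k * s
sum-scaled-bound {zero} f d s small = z≤n
sum-scaled-bound {suc k} f d s small = begin
  suc k + (f zero + sum (f ∘ suc)) * d
    ≡⟨ cong (suc k +_) (*-distribʳ-+ d (f zero) (sum (f ∘ suc))) ⟩
  suc k + (f zero * d + sum (f ∘ suc) * d)
    ≡⟨ cong suc (x∙yz≈y∙xz k (f zero * d) (sum (f ∘ suc) * d)) ⟩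
  suc (f zero * d) + (k + sum (f ∘ suc) * d)
    ≤⟨ +-mono-≤ (small zero) (sum-scaled-bound (f ∘ suc) d s (small ∘ suc)) ⟩
  s + k * s
    ∎
  where open ≤-Reasoning

some-above-average : ∀ {n m} (a : Fin n → ℕ) (b : Fin m → ℕ) → 0 < n + m →
  (∃[ i ] sum a + sum b ≤ a i * (n + m)) ⊎ (∃[ j ] sum a + sum b ≤ b j * (n + m))
some-above-average {n} {m} a b positive
  with any? (λ i → sum a + sum b ≤? a i * (n + m)) | any? (λ j → sum a + sum b ≤? b j * (n + m))
... | yes large  | _          = inj₁ large
... | no _       | yes large  = inj₂ large
... | no small-a | no small-b =
  ⊥-elim (m+1+n≰m (S * D) (≤-trans (+-monoʳ-≤ (S * D) positive) impossible))
  where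
  S = sum a + sum b
  D = n + m
  open ≤-Reasoning
  impossible : S * D + D ≤ S * D
  impossible = begin
    S * D + D
      ≡⟨ cong (_+ D) (*-distribʳ-+ D (sum a) (sum b)) ⟩
    (sum a * D + sum b * D) + (n + m)
      ≡⟨ interchange (sum a * D) (sum b * D) n m ⟩
    (sum a * D + n) + (sum b * D + m)
      ≡⟨ cong₂ _+_ (+-comm (sum a * D) n) (+-comm (sum b * D) m) ⟩
    (n + sum a * D) + (m + sum b * D)
      ≤⟨ +-mono-≤ (sum-scaled-bound a D S (λ i → ≰⇒> (λ large → small-a (i , large))))
                  (sum-scaled-bound b D S (λ j → ≰⇒> (λ large → small-b (j , large)))) ⟩
    n * S + m * S
      ≡⟨ trans (sym (*-distribʳ-+ S n m)) (*-comm D S) ⟩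
    S * D
      ∎

module Visiting {N M K : ℕ} (node : Fin K → PosSet N M) (SU : Submatrix N M → Fin K → Bool) where

  visitsAtLeast-count : ∀ {k} B (p : Fin k → Bool) (f : Fin k → Fin K) → Injective _≡_ _≡_ f →
    (∀ i → p i ≡ true → Visited node SU B (f i)) → VisitsAtLeast node SU B (count p)
  visitsAtLeast-count B p f f-injective visits =
    f ∘ enumerate p , enumerate-injective p ∘ f-injective , λ j → visits _ (enumerate-sound p j)

  module Covering {A : Set} {_▽_ : A → A → A} (valid : ValidSU _▽_ node SU) where
    open ValidSU valid

    covering : ∀ B {x y} → InSub B x y → ∃[ i ] (SU B i ≡ true × node i x y ≡ true)
    covering B {x} {y} = to (cover B x y)

    chosen⊆ : ∀ B {i x y} → SU B i ≡ true → node i x y ≡ true → InSub B x y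
    chosen⊆ B {i} {x} {y} chosen i∋xy = from (cover B x y) (i , chosen , i∋xy)

    visited-if-sticks-out : ∀ B {i j x y} → SU B i ≡ true → Intersects (node j) (node i) →
      node j x y ≡ true → ¬ InSub B x y → Visited node SU B j
    visited-if-sticks-out B {i} chosen meets j∋xy xy∉B =
      inj₂ ((i , chosen , meets) ,
            λ i′ chosen′ j⊆i′ → xy∉B (chosen⊆ B chosen′ (j⊆i′ _ _ j∋xy)))

module RowsAndColumns {n m K : ℕ} {A : Set} {_▽_ : A → A → A}
  (node : Fin K → PosSet (suc n) (suc m)) (system : NodeSystem (suc n) (suc m) K node)
  (SU : Submatrix (suc n) (suc m) → Fin K → Bool) (valid : ValidSU _▽_ node SU) where

  open Visiting node SU
  open Covering valid

  row : Fin (suc n) → Submatrix (suc n) (suc m)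
  row r = sub r r zero (fromℕ m) ≤-refl z≤n

  column : Fin (suc m) → Submatrix (suc n) (suc m)
  column c = sub zero (fromℕ n) c c z≤n ≤-refl

  row∋ : ∀ r c → InSub (row r) r c
  row∋ r c = (≤-refl , ≤-refl) , (z≤n , ≤fromℕ c)

  column∋ : ∀ r c → InSub (column c) r c
  column∋ r c = (z≤n , ≤fromℕ r) , (≤-refl , ≤-refl)

  ∈row⇒≡ : ∀ {r x y} → InSub (row r) x y → x ≡ r
  ∈row⇒≡ ((r≤x , x≤r) , _) = ≤-antisym x≤r r≤x

  ∈column⇒≡ : ∀ {c x y} → InSub (column c) x y → y ≡ c
  ∈column⇒≡ (_ , (c≤y , y≤c)) = ≤-antisym y≤c c≤y

  rowNode : Fin (suc n) → Fin (suc m) → Fin K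
  rowNode r c = proj₁ (covering (row r) (row∋ r c))

  rowNode-chosen : ∀ r c → SU (row r) (rowNode r c) ≡ true
  rowNode-chosen r c = proj₁ (proj₂ (covering (row r) (row∋ r c)))

  rowNode∋ : ∀ r c → node (rowNode r c) r c ≡ true
  rowNode∋ r c = proj₂ (proj₂ (covering (row r) (row∋ r c)))

  columnNode : Fin (suc n) → Fin (suc m) → Fin K
  columnNode r c = proj₁ (covering (column c) (column∋ r c))

  columnNode-chosen : ∀ r c → SU (column c) (columnNode r c) ≡ true
  columnNode-chosen r c = proj₁ (proj₂ (covering (column c) (column∋ r c)))

  columnNode∋ : ∀ r c → node (columnNode r c) r c ≡ true
  columnNode∋ r c = proj₂ (proj₂ (covering (column c) (column∋ r c)))

  Escapes : Fin K → Fin (suc n) → Fin (suc m) → Set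
  Escapes i r c = ∃[ x ] ∃[ y ] (node i x y ≡ true × ¬ (x ≡ r × y ≡ c))

  escapes? : ∀ i r c → Dec (Escapes i r c)
  escapes? i r c = any? λ x → any? λ y →
    (node i x y ≟ᵇ true) ×-dec ¬? ((x ≟ r) ×-dec (y ≟ c))

  ⊆-singleton : ∀ {i r c} → ¬ Escapes i r c → ∀ {x y} → node i x y ≡ true → x ≡ r × y ≡ c
  ⊆-singleton {i} {r} {c} stays {x} {y} i∋xy with (x ≟ r) ×-dec (y ≟ c)
  ... | yes xy≡rc = xy≡rc
  ... | no xy≢rc = ⊥-elim (stays (x , y , i∋xy , xy≢rc))

  singleton-unique : ∀ {i j r c} → ¬ Escapes i r c → ¬ Escapes j r c →
    node i r c ≡ true → node j r c ≡ true → i ≡ j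
  singleton-unique {i} {j} i-stays j-stays i∋rc j∋rc =
    NodeSystem.distinct system i j λ x y →
      ⇔→≡ (mk⇔ (moves j∋rc ∘ ⊆-singleton i-stays) (moves i∋rc ∘ ⊆-singleton j-stays))
    where
    moves : ∀ {k r c x y} → node k r c ≡ true → x ≡ r × y ≡ c → node k x y ≡ true
    moves k∋rc (refl , refl) = k∋rc

  columnNode-visited-by-row : ∀ r c → Escapes (columnNode r c) r c →
    Visited node SU (row r) (columnNode r c)
  columnNode-visited-by-row r c (x , y , ∋xy , xy≢rc) =
    visited-if-sticks-out (row r) (rowNode-chosen r c) (r , c , columnNode∋ r c , rowNode∋ r c) ∋xy
      λ xy∈row →
        xy≢rc (∈row⇒≡ xy∈row , ∈column⇒≡ (chosen⊆ (column c) (columnNode-chosen r c) ∋xy))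

  rowNode-visited-by-column : ∀ r c → Escapes (rowNode r c) r c →
    Visited node SU (column c) (rowNode r c)
  rowNode-visited-by-column r c (x , y , ∋xy , xy≢rc) =
    visited-if-sticks-out (column c) (columnNode-chosen r c) (r , c , rowNode∋ r c , columnNode∋ r c) ∋xy
      λ xy∈column →
        xy≢rc (∈row⇒≡ (chosen⊆ (row r) (rowNode-chosen r c) ∋xy) , ∈column⇒≡ xy∈column)

  chargedToColumn : Fin (suc n) → Fin (suc m) → Bool
  chargedToColumn r c = isYes (escapes? (rowNode r c) r c)

  row-visits-columnNode : ∀ r c → ¬ Escapes (rowNode r c) r c → Visited node SU (row r) (columnNode r c)
  row-visits-columnNode r c ρ-stays with escapes? (columnNode r c) r c
  ... | yes κ-escapes = columnNode-visited-by-row r c κ-escapes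
  ... | no κ-stays =
    inj₁ (subst (λ i → SU (row r) i ≡ true)
                (singleton-unique ρ-stays κ-stays (rowNode∋ r c) (columnNode∋ r c))
                (rowNode-chosen r c))

  row-visits : ∀ r c → not (chargedToColumn r c) ≡ true → Visited node SU (row r) (columnNode r c)
  row-visits r c charged =
    row-visits-columnNode r c (toWitnessFalse (from (T-≡ {not (chargedToColumn r c)}) charged))

  column-visits : ∀ r c → chargedToColumn r c ≡ true → Visited node SU (column c) (rowNode r c)
  column-visits r c charged =
    rowNode-visited-by-column r c (toWitness (from (T-≡ {chargedToColumn r c}) charged))

  columnNode-injective : ∀ r → Injective _≡_ _≡_ (columnNode r)
  columnNode-injective r {c} {c′} same =
    ∈column⇒≡ (chosen⊆ (column c′) (columnNode-chosen r c′)
                       (subst (λ i → node i r c ≡ true) same (columnNode∋ r c)))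

  rowNode-injective : ∀ c → Injective _≡_ _≡_ (λ r → rowNode r c)
  rowNode-injective c {r} {r′} same =
    ∈row⇒≡ (chosen⊆ (row r′) (rowNode-chosen r′ c)
                    (subst (λ i → node i r c ≡ true) same (rowNode∋ r c)))

  rowLoad : Fin (suc n) → ℕ
  rowLoad r = count (not ∘ chargedToColumn r)

  columnLoad : Fin (suc m) → ℕ
  columnLoad c = count (λ r → chargedToColumn r c)

  total-load : sum rowLoad + sum columnLoad ≡ suc n * suc m
  total-load = count-rows+count-columns chargedToColumn

  row-visitsAtLeast : ∀ r → VisitsAtLeast node SU (row r) (rowLoad r)
  row-visitsAtLeast r =
    visitsAtLeast-count (row r) (not ∘ chargedToColumn r) (columnNode r) (columnNode-injective r)
      (row-visits r)

  column-visitsAtLeast : ∀ c → VisitsAtLeast node SU (column c) (columnLoad c)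
  column-visitsAtLeast c =
    visitsAtLeast-count (column c) (λ r → chargedToColumn r c) (λ r → rowNode r c) (rowNode-injective c)
      (λ r → column-visits r c)

  Heavy : Set
  Heavy = ∃[ B ] ∃[ v ] (suc n * suc m ≤ v * (suc n + suc m) × VisitsAtLeast node SU B v)

  heavy-row : (∃[ r ] sum rowLoad + sum columnLoad ≤ rowLoad r * (suc n + suc m)) → Heavy
  heavy-row (r , heavy) =
    row r , rowLoad r , subst (_≤ rowLoad r * (suc n + suc m)) total-load heavy ,
    row-visitsAtLeast r

  heavy-column : (∃[ c ] sum rowLoad + sum columnLoad ≤ columnLoad c * (suc n + suc m)) → Heavy
  heavy-column (c , heavy) =
    column c , columnLoad c , subst (_≤ columnLoad c * (suc n + suc m)) total-load heavy ,
    column-visitsAtLeast c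

theorem4 : (N M : ℕ) → .{{_ : NonZero N}} → .{{_ : NonZero M}} →
           {A : Set} (_▽_ : A → A → A) →
           (K : ℕ) (node : Fin K → PosSet N M) → NodeSystem N M K node →
           (SU : Submatrix N M → Fin K → Bool) → ValidSU _▽_ node SU →
           ∃[ B ] ∃[ c ] (N * M ≤ c * (N + M) × VisitsAtLeast node SU B c)
theorem4 (suc n) (suc m) _▽_ K node system SU valid =
  [ heavy-row , heavy-column ]′ (some-above-average rowLoad columnLoad (s≤s z≤n))
  where open RowsAndColumns node system SU valid
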